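{- Let $\mathcal{F}$ be a finite $3$-uniform linear family and let $\mathcal{M}$ be a matching (not necessarily maximum) of $\mathcal{F}$ with $n=|\mathcal{M}|\geq 3$. If $|D_2(A,B,C)|\leq 21$ for all $3$-element subsets $\{A,B,C\}\subseteq\mathcal{M}$, then $|D_2(\mathcal{F},\mathcal{M})|+|D_3(\mathcal{F},\mathcal{M})\setminus\mathcal{M}|\leq \frac{23}{n-2}\binom{n}{3}$.
   Context: $3$-uniform: every member has exactly $3$ elements; linear: distinct members share at most one element. A matching is a set of pairwise disjoint members. $X_{\mathcal{M}}=\bigcup_{A\in\mathcal{M}}A$; for $i\in\{0,1,2,3\}$, $D_i(\mathcal{F},\mathcal{M})=\{A\in\mathcal{F}: |A\cap X_{\mathcal{M}}|=i\}$; for $\{A,B,C\}\subseteq\mathcal{M}$, $D_2(A,B,C)=\{E\in D_2(\mathcal{F},\mathcal{M}): |E\cap(A\cup B\cup C)|=2\}$. -}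

module Defs where

open import Data.Nat using (ℕ; _≤_; _≟_)
open import Data.Bool using (Bool)
import Data.Bool as B
open import Data.Fin.Subset using (Subset; _∩_; _∪_; ∣_∣; ⋃)
open import Data.List using (List; filter; length)
open import Data.List.Membership.Propositional using (_∈_; _∉_)
open import Data.List.Relation.Unary.Unique.Propositional using (Unique)
open import Data.Vec.Properties using (≡-dec)
open import Relation.Binary.PropositionalEquality using (_≡_; _≢_)
open import Relation.Binary.Definitions using (DecidableEquality)
open import Relation.Nullary using (¬_)
open import Relation.Nullary.Decidable using (_×-dec_; ¬?)
open import Data.Product using (_×_)
open import Data.List.Membership.DecPropositional as DM using ()

-- Ground set: Fin v (a finite family only involves finitely many points).
-- Members of a family are subsets of Fin v; a family is a duplicate-free list.

_≟ₛ_ : ∀ {v} → DecidableEquality (Subset v)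
_≟ₛ_ = ≡-dec B._≟_

_∈?ₛ_ : ∀ {v} (A : Subset v) (xs : List (Subset v)) → Relation.Nullary.Dec (A ∈ xs)
_∈?ₛ_ = DM._∈?_ _≟ₛ_

IsFamily : ∀ {v} → List (Subset v) → Set
IsFamily F = Unique F

ThreeUniform : ∀ {v} → List (Subset v) → Set
ThreeUniform F = ∀ {A} → A ∈ F → ∣ A ∣ ≡ 3

Linear : ∀ {v} → List (Subset v) → Set
Linear F = ∀ {A B} → A ∈ F → B ∈ F → A ≢ B → ∣ A ∩ B ∣ ≤ 1

IsMatching : ∀ {v} → List (Subset v) → List (Subset v) → Set
IsMatching F M = Unique M × (∀ {A} → A ∈ M → A ∈ F)
  × (∀ {A B} → A ∈ M → B ∈ M → A ≢ B → ∣ A ∩ B ∣ ≡ 0)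

X : ∀ {v} → List (Subset v) → Subset v
X M = ⋃ M

D : ∀ {v} → ℕ → List (Subset v) → List (Subset v) → List (Subset v)
D i F M = filter (λ A → ∣ A ∩ X M ∣ ≟ i) F

D2₃ : ∀ {v} → List (Subset v) → List (Subset v) → Subset v → Subset v → Subset v → List (Subset v)
D2₃ F M A B C = filter (λ E → ∣ E ∩ (A ∪ (B ∪ C)) ∣ ≟ 2) (D 2 F M)

D3∖M : ∀ {v} → List (Subset v) → List (Subset v) → List (Subset v)
D3∖M F M = filter (λ E → ¬? (E ∈?ₛ M)) (D 3 F M)

-- Two double counts. Pairs of points of X_M: each member E of F contributes the
-- C(|E ∩ X_M|, 2) pairs inside E ∩ X_M, and linearity makes these pairs distinct, so
-- |D_2| + 3|D_3 ∖ M| + 3n ≤ C(3n, 2) = 9 C(n, 2) + 3n. Triples of M: a member of D_2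
-- meets exactly two members of M, each in one point, so it lies in D_2(A,B,C) for
-- exactly n - 2 triples, whence (n - 2)|D_2| = Σ |D_2(A,B,C)| ≤ 21 C(n, 3).
-- Adding the first bound times (n - 2) to twice the second, and using
-- C(n, 2)(n - 2) = 3 C(n, 3), gives 3(|D_2| + |D_3 ∖ M|)(n - 2) ≤ 69 C(n, 3).
module Submission where

open import Defs
open import Level using (Level)
open import Function using (_∘_)
open import Data.Bool using (if_then_else_)
open import Data.Nat using (ℕ; zero; suc; _≤_; _*_; _+_; _∸_; _≟_; s≤s)
open import Data.Nat.Properties
open import Algebra.Properties.CommutativeSemigroup +-commutativeSemigroup using (interchange)
open import Data.Nat.Combinatorics using (_C_; nC1≡n; nCk+nC[k+1]≡[n+1]C[k+1])
open import Data.Nat.Tactic.RingSolver using (solve-∀)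
open import Data.Product using (_×_; _,_; proj₁; proj₂)
open import Data.Sum using (inj₁; inj₂)
open import Data.Vec using ([]; _∷_; tail)
open import Data.List using (List; []; _∷_; [_]; _++_; length; map; filter)
open import Data.List.Properties using (length-++)
open import Data.List.Membership.Propositional using (_∈_; _∉_)
open import Data.List.Membership.Propositional.Properties using (∈-filter⁻; ∈-++⁻)
open import Data.List.Relation.Unary.Any using (here; there)
open import Data.List.Relation.Unary.All as All using (All; []; _∷_)
import Data.List.Relation.Unary.All.Properties as Allₚ
open import Data.List.Relation.Unary.AllPairs as AllPairs using (AllPairs; []; _∷_)
import Data.List.Relation.Unary.AllPairs.Properties as AllPairsₚ
open import Data.List.Relation.Unary.Unique.Propositional using (Unique)
import Data.List.Relation.Unary.Unique.Propositional.Properties as Uniqueₚ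
open import Data.List.Relation.Binary.Sublist.Propositional using (_⊆_; []; _∷_; _∷ʳ_)
open import Data.List.Relation.Binary.Sublist.Propositional.Properties using (All-resp-⊆; Any-resp-⊆)
open import Data.Fin.Subset using (Subset; _∩_; _∪_; ∣_∣; ⊤; ⋃; inside; outside)
open import Data.Fin.Subset.Properties
  using (∩-comm; ∩-idem; ∩-identityˡ; ∩-zeroʳ; ∪-identityʳ; ∣⊥∣≡0; ∣p∩q∣≤∣p∣)
open import Relation.Nullary using (Dec; does; yes; no; ¬?)
open import Relation.Unary using (Pred; Decidable)
open import Relation.Unary.Properties using (∁?)
open import Relation.Binary.PropositionalEquality
  using (_≡_; _≢_; refl; sym; trans; cong; cong₂; module ≡-Reasoning)

private variable
  a b p r s : Level
  A : Set a
  B : Set b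
  n : ℕ

∑ : (A → ℕ) → List A → ℕ
∑ f []       = 0
∑ f (x ∷ xs) = f x + ∑ f xs

𝟙 : {P : Set p} → Dec P → ℕ
𝟙 d = if does d then 1 else 0

count : {P : Pred A p} → Decidable P → List A → ℕ
count P? = ∑ (𝟙 ∘ P?)

∑-cong : {f g : A → ℕ} {xs : List A} → All (λ x → f x ≡ g x) xs → ∑ f xs ≡ ∑ g xs
∑-cong []         = refl
∑-cong (eq ∷ eqs) = cong₂ _+_ eq (∑-cong eqs)

module _ {f : A → ℕ} where

  ∑-const : ∀ {k xs} → All (λ x → f x ≡ k) xs → ∑ f xs ≡ length xs * k
  ∑-const []         = refl
  ∑-const (eq ∷ eqs) = cong₂ _+_ eq (∑-const eqs)

  ∑-zero : ∀ {xs} → All (λ x → f x ≡ 0) xs → ∑ f xs ≡ 0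
  ∑-zero {xs} eqs = trans (∑-const eqs) (*-zeroʳ (length xs))

  ∑-≤-const : ∀ {k xs} → All (λ x → f x ≤ k) xs → ∑ f xs ≤ length xs * k
  ∑-≤-const []         = ≤-refl
  ∑-≤-const (le ∷ les) = +-mono-≤ le (∑-≤-const les)

  ∑-++ : ∀ xs ys → ∑ f (xs ++ ys) ≡ ∑ f xs + ∑ f ys
  ∑-++ []       ys = refl
  ∑-++ (x ∷ xs) ys = trans (cong (f x +_) (∑-++ xs ys)) (sym (+-assoc (f x) _ _))

  ∑-map : (g : B → A) → ∀ xs → ∑ f (map g xs) ≡ ∑ (f ∘ g) xs
  ∑-map g []       = refl
  ∑-map g (x ∷ xs) = cong (f (g x) +_) (∑-map g xs)

  ∑-single : ∀ {x xs} → Unique xs → x ∈ xs → (∀ {y} → y ∈ xs → y ≢ x → f y ≡ 0) → ∑ f xs ≡ f x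
  ∑-single {x} (x∉xs ∷ _) (here refl) others = trans
    (cong (f x +_) (∑-zero (All.tabulate λ y∈xs → others (there y∈xs) (All.lookup x∉xs y∈xs ∘ sym))))
    (+-identityʳ (f x))
  ∑-single {xs = y ∷ ys} (y∉ys ∷ u) (there x∈ys) others =
    trans (cong (_+ ∑ f ys) (others (here refl) (All.lookup y∉ys x∈ys)))
          (∑-single u x∈ys (others ∘ there))

∑-+ : (f g : A → ℕ) → ∀ xs → ∑ (λ x → f x + g x) xs ≡ ∑ f xs + ∑ g xs
∑-+ f g []       = refl
∑-+ f g (x ∷ xs) =
  trans (cong (f x + g x +_) (∑-+ f g xs)) (interchange (f x) (g x) (∑ f xs) (∑ g xs))

∑-swap : (g : A → B → ℕ) → ∀ xs ys →
  ∑ (λ x → ∑ (g x) ys) xs ≡ ∑ (λ y → ∑ (λ x → g x y) xs) ys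
∑-swap g []       ys = sym (∑-zero (All.universal (λ _ → refl) ys))
∑-swap g (x ∷ xs) ys = trans (cong (∑ (g x) ys +_) (∑-swap g xs ys)) (sym (∑-+ (g x) _ ys))

module _ {P : Pred A p} (P? : Decidable P) where

  length-filter≡count : ∀ xs → length (filter P? xs) ≡ count P? xs
  length-filter≡count []       = refl
  length-filter≡count (x ∷ xs) with P? x
  ... | yes _ = cong suc (length-filter≡count xs)
  ... | no  _ = length-filter≡count xs

  ∑-filter : (f : A → ℕ) → ∀ xs → ∑ f (filter P? xs) ≡ ∑ (λ x → 𝟙 (P? x) * f x) xs
  ∑-filter f []       = refl
  ∑-filter f (x ∷ xs) with P? x
  ... | yes _ = cong₂ _+_ (sym (+-identityʳ (f x))) (∑-filter f xs)
  ... | no  _ = ∑-filter f xs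

  length≡count+count∁ : ∀ xs → length xs ≡ count P? xs + count (∁? P?) xs
  length≡count+count∁ []       = refl
  length≡count+count∁ (x ∷ xs) with P? x
  ... | yes _ = cong suc (length≡count+count∁ xs)
  ... | no  _ = trans (cong suc (length≡count+count∁ xs)) (sym (+-suc _ _))

∑-bits : (w : A → ℕ) → ∀ {xs} → All (λ x → w x ≤ 1) xs → ∑ w xs ≡ count (λ x → w x ≟ 1) xs
∑-bits w []                             = refl
∑-bits w {x ∷ xs} (_ ∷ ws) with w x
∑-bits w {x ∷ xs} (_ ∷ ws)      | zero     = ∑-bits w ws
∑-bits w {x ∷ xs} (_ ∷ ws)      | suc zero = cong suc (∑-bits w ws)
∑-bits w {x ∷ xs} (s≤s () ∷ _)  | suc (suc _)

AllPairs-map-∈ : {R : A → A → Set r} {S : A → A → Set s} {xs : List A} →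
  (∀ {x y} → x ∈ xs → y ∈ xs → R x y → S x y) → AllPairs R xs → AllPairs S xs
AllPairs-map-∈ f []         = []
AllPairs-map-∈ f (Rx ∷ Rxs) =
  All.tabulate (λ y∈xs → f (here refl) (there y∈xs) (All.lookup Rx y∈xs))
    ∷ AllPairs-map-∈ (λ x∈xs y∈xs → f (there x∈xs) (there y∈xs)) Rxs

AllPairs-resp-⊆ : {R : A → A → Set r} {xs ys : List A} → ys ⊆ xs → AllPairs R xs → AllPairs R ys
AllPairs-resp-⊆ []             []         = []
AllPairs-resp-⊆ (_ ∷ʳ ys⊆xs)   (_ ∷ Rxs)  = AllPairs-resp-⊆ ys⊆xs Rxs
AllPairs-resp-⊆ (refl ∷ ys⊆xs) (Rx ∷ Rxs) = All-resp-⊆ ys⊆xs Rx ∷ AllPairs-resp-⊆ ys⊆xs Rxs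

Disjoint : Subset n → Subset n → Set
Disjoint p q = ∣ p ∩ q ∣ ≡ 0

AlmostDisjoint : Subset n → Subset n → Set
AlmostDisjoint p q = ∣ p ∩ q ∣ ≤ 1

∣∩∪∣≡∣∩∣+∣∩∣ : (p q r : Subset n) → Disjoint q r → ∣ p ∩ (q ∪ r) ∣ ≡ ∣ p ∩ q ∣ + ∣ p ∩ r ∣
∣∩∪∣≡∣∩∣+∣∩∣ []            []            []            _  = refl
∣∩∪∣≡∣∩∣+∣∩∣ (_ ∷ p)       (inside ∷ q)  (inside ∷ r)  ()
∣∩∪∣≡∣∩∣+∣∩∣ (inside ∷ p)  (inside ∷ q)  (outside ∷ r) qr = cong suc (∣∩∪∣≡∣∩∣+∣∩∣ p q r qr)
∣∩∪∣≡∣∩∣+∣∩∣ (inside ∷ p)  (outside ∷ q) (inside ∷ r)  qr =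
  trans (cong suc (∣∩∪∣≡∣∩∣+∣∩∣ p q r qr)) (sym (+-suc _ _))
∣∩∪∣≡∣∩∣+∣∩∣ (inside ∷ p)  (outside ∷ q) (outside ∷ r) qr = ∣∩∪∣≡∣∩∣+∣∩∣ p q r qr
∣∩∪∣≡∣∩∣+∣∩∣ (outside ∷ p) (inside ∷ q)  (outside ∷ r) qr = ∣∩∪∣≡∣∩∣+∣∩∣ p q r qr
∣∩∪∣≡∣∩∣+∣∩∣ (outside ∷ p) (outside ∷ q) (inside ∷ r)  qr = ∣∩∪∣≡∣∩∣+∣∩∣ p q r qr
∣∩∪∣≡∣∩∣+∣∩∣ (outside ∷ p) (outside ∷ q) (outside ∷ r) qr = ∣∩∪∣≡∣∩∣+∣∩∣ p q r qr

∣∩⋃∣≡∑ : ∀ {n} (p : Subset n) {qs : List (Subset n)} → AllPairs Disjoint qs →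
  ∣ p ∩ ⋃ qs ∣ ≡ ∑ (λ q → ∣ p ∩ q ∣) qs
∣∩⋃∣≡∑ {n} p {[]}     []                = trans (cong ∣_∣ (∩-zeroʳ p)) (∣⊥∣≡0 n)
∣∩⋃∣≡∑     p {q ∷ qs} (q#qs ∷ qs-disj) =
  trans (∣∩∪∣≡∣∩∣+∣∩∣ p q (⋃ qs) (trans (∣∩⋃∣≡∑ q qs-disj) (∑-zero q#qs)))
        (cong (∣ p ∩ q ∣ +_) (∣∩⋃∣≡∑ p qs-disj))

[1+n]C2≡n+nC2 : ∀ n → suc n C 2 ≡ n + n C 2
[1+n]C2≡n+nC2 n = trans (sym (nCk+nC[k+1]≡[n+1]C[k+1] n 1)) (cong (_+ n C 2) (nC1≡n n))

[1+n]C3≡nC2+nC3 : ∀ n → suc n C 3 ≡ n C 2 + n C 3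
[1+n]C3≡nC2+nC3 n = sym (nCk+nC[k+1]≡[n+1]C[k+1] n 2)

through : List (Subset (suc n)) → List (Subset n)
through []                  = []
through ((inside ∷ p) ∷ ps)  = p ∷ through ps
through ((outside ∷ p) ∷ ps) = through ps

through-disjoint : {ps : List (Subset (suc n))} →
  AllPairs AlmostDisjoint ps → AllPairs Disjoint (through ps)
through-disjoint {ps = []}                  []           = []
through-disjoint {ps = (inside ∷ p) ∷ ps}   (p#ps ∷ ps#) = disjoint-from-p p#ps ∷ through-disjoint ps#
  where
  disjoint-from-p : ∀ {qs} → All (AlmostDisjoint (inside ∷ p)) qs → All (Disjoint p) (through qs)
  disjoint-from-p {[]}                  []               = []
  disjoint-from-p {(inside ∷ q) ∷ qs}   (s≤s pq≤0 ∷ pqs) = n≤0⇒n≡0 pq≤0 ∷ disjoint-from-p pqs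
  disjoint-from-p {(outside ∷ q) ∷ qs}  (_ ∷ pqs)        = disjoint-from-p pqs
through-disjoint {ps = (outside ∷ p) ∷ ps}  (_ ∷ ps#)    = through-disjoint ps#

tail-almostDisjoint : {ps : List (Subset (suc n))} →
  AllPairs AlmostDisjoint ps → AllPairs AlmostDisjoint (map tail ps)
tail-almostDisjoint ps# = AllPairsₚ.map⁺ (AllPairs.map (λ {p} {q} → ≤-trans (∣tail∩tail∣≤∣∩∣ p q)) ps#)
  where
  ∣tail∩tail∣≤∣∩∣ : (p q : Subset (suc n)) → ∣ tail p ∩ tail q ∣ ≤ ∣ p ∩ q ∣
  ∣tail∩tail∣≤∣∩∣ (inside ∷ p)  (inside ∷ q)  = n≤1+n _
  ∣tail∩tail∣≤∣∩∣ (inside ∷ p)  (outside ∷ q) = ≤-refl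
  ∣tail∩tail∣≤∣∩∣ (outside ∷ p) (inside ∷ q)  = ≤-refl
  ∣tail∩tail∣≤∣∩∣ (outside ∷ p) (outside ∷ q) = ≤-refl

∑C2-outside : (q : Subset n) (ps : List (Subset (suc n))) →
  ∑ (λ p → ∣ p ∩ (outside ∷ q) ∣ C 2) ps ≡ ∑ (λ p → ∣ p ∩ q ∣ C 2) (map tail ps)
∑C2-outside q []                  = refl
∑C2-outside q ((inside ∷ p) ∷ ps)  = cong (∣ p ∩ q ∣ C 2 +_) (∑C2-outside q ps)
∑C2-outside q ((outside ∷ p) ∷ ps) = cong (∣ p ∩ q ∣ C 2 +_) (∑C2-outside q ps)

∑C2-inside : (q : Subset n) (ps : List (Subset (suc n))) →
  ∑ (λ p → ∣ p ∩ (inside ∷ q) ∣ C 2) ps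
    ≡ ∑ (λ p → ∣ p ∩ q ∣ C 2) (map tail ps) + ∑ (λ p → ∣ p ∩ q ∣) (through ps)
∑C2-inside q []                  = refl
∑C2-inside q ((inside ∷ p) ∷ ps)  =
  trans (cong₂ _+_ ([1+n]C2≡n+nC2 ∣ p ∩ q ∣) (∑C2-inside q ps)) (rearrange ∣ p ∩ q ∣ _ _ _)
  where
  rearrange : ∀ a b c d → (a + b) + (c + d) ≡ (b + c) + (a + d)
  rearrange = solve-∀
∑C2-inside q ((outside ∷ p) ∷ ps) =
  trans (cong (∣ p ∩ q ∣ C 2 +_) (∑C2-inside q ps)) (sym (+-assoc (∣ p ∩ q ∣ C 2) _ _))

-- Pairs of points of q, counted by induction on the ground set: the members p through the
-- first point of q have pairwise disjoint remainders, so together they cover at most ∣ q ∣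
-- of the pairs containing that point.
∑C2-≤ : (q : Subset n) {ps : List (Subset n)} → AllPairs AlmostDisjoint ps →
  ∑ (λ p → ∣ p ∩ q ∣ C 2) ps ≤ ∣ q ∣ C 2
∑C2-≤ [] {ps} _ = ≤-reflexive (∑-zero (All.universal (λ { [] → refl }) ps))
∑C2-≤ (outside ∷ q) {ps} ps# = begin
  ∑ (λ p → ∣ p ∩ (outside ∷ q) ∣ C 2) ps ≡⟨ ∑C2-outside q ps ⟩
  ∑ (λ p → ∣ p ∩ q ∣ C 2) (map tail ps)  ≤⟨ ∑C2-≤ q (tail-almostDisjoint ps#) ⟩
  ∣ q ∣ C 2                             ∎
  where open ≤-Reasoning
∑C2-≤ (inside ∷ q) {ps} ps# = begin
  ∑ (λ p → ∣ p ∩ (inside ∷ q) ∣ C 2) ps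
    ≡⟨ ∑C2-inside q ps ⟩
  ∑ (λ p → ∣ p ∩ q ∣ C 2) (map tail ps) + ∑ (λ p → ∣ p ∩ q ∣) (through ps)
    ≤⟨ +-mono-≤ (∑C2-≤ q (tail-almostDisjoint ps#)) through-≤ ⟩
  ∣ q ∣ C 2 + ∣ q ∣
    ≡⟨ +-comm _ ∣ q ∣ ⟩
  ∣ q ∣ + ∣ q ∣ C 2
    ≡⟨ [1+n]C2≡n+nC2 ∣ q ∣ ⟨
  suc ∣ q ∣ C 2
    ∎
  where
  open ≤-Reasoning
  through-≤ : ∑ (λ p → ∣ p ∩ q ∣) (through ps) ≤ ∣ q ∣
  through-≤ = begin
    ∑ (λ p → ∣ p ∩ q ∣) (through ps) ≡⟨ ∑-cong (All.universal (λ p → cong ∣_∣ (∩-comm p q)) (through ps)) ⟩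
    ∑ (λ p → ∣ q ∩ p ∣) (through ps) ≡⟨ ∣∩⋃∣≡∑ q (through-disjoint ps#) ⟨
    ∣ q ∩ ⋃ (through ps) ∣           ≤⟨ ∣p∩q∣≤∣p∣ q _ ⟩
    ∣ q ∣                            ∎

subsequences : List A → List (List A)
subsequences []       = [ [] ]
subsequences (x ∷ xs) = map (x ∷_) (subsequences xs) ++ subsequences xs

subsequences-⊆ : (xs : List A) → All (_⊆ xs) (subsequences xs)
subsequences-⊆ []       = [] ∷ []
subsequences-⊆ (x ∷ xs) = Allₚ.++⁺ (Allₚ.map⁺ (All.map (refl ∷_) ys⊆xs)) (All.map (x ∷ʳ_) ys⊆xs)
  where ys⊆xs = subsequences-⊆ xs

∑-subsequences-∷ : (f : List A → ℕ) (x : A) (xs : List A) →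
  ∑ f (subsequences (x ∷ xs)) ≡ ∑ (f ∘ (x ∷_)) (subsequences xs) + ∑ f (subsequences xs)
∑-subsequences-∷ f x xs =
  trans (∑-++ (map (x ∷_) (subsequences xs)) _) (cong (_+ _) (∑-map (x ∷_) (subsequences xs)))

∑-subsequences-length : (xs : List A) (k : ℕ) →
  ∑ (λ ys → 𝟙 (length ys ≟ k)) (subsequences xs) ≡ length xs C k
∑-subsequences-length []       zero    = refl
∑-subsequences-length []       (suc k) = refl
∑-subsequences-length (x ∷ xs) k       = trans (∑-subsequences-∷ _ x xs) (by-size k)
  where
  of-size : ℕ → ℕ
  of-size k = ∑ (λ ys → 𝟙 (length ys ≟ k)) (subsequences xs)
  by-size : ∀ k → ∑ (λ ys → 𝟙 (suc (length ys) ≟ k)) (subsequences xs) + of-size k ≡ suc (length xs) C k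
  by-size zero    =
    trans (cong (_+ of-size 0) (∑-zero (All.universal (λ _ → refl) (subsequences xs))))
          (∑-subsequences-length xs zero)
  by-size (suc k) =
    trans (cong₂ _+_ (∑-subsequences-length xs k) (∑-subsequences-length xs (suc k)))
          (nCk+nC[k+1]≡[n+1]C[k+1] (length xs) k)

module _ {P : Pred A p} (P? : Decidable P) where

  ∑-subsequences-counts : (xs : List A) (j i : ℕ) →
    ∑ (λ ys → 𝟙 (count P? ys ≟ j) * 𝟙 (count (∁? P?) ys ≟ i)) (subsequences xs)
      ≡ (count P? xs C j) * (count (∁? P?) xs C i)
  ∑-subsequences-counts []       zero    zero    = refl
  ∑-subsequences-counts []       zero    (suc i) = refl
  ∑-subsequences-counts []       (suc j) i       = refl
  ∑-subsequences-counts (x ∷ xs) j       i       = trans (∑-subsequences-∷ _ x xs) (by-head (P? x) j i)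
    where
    c c̄ : ℕ
    c = count P? xs
    c̄ = count (∁? P?) xs
    with-counts : ℕ → ℕ → ℕ
    with-counts j i = ∑ (λ ys → 𝟙 (count P? ys ≟ j) * 𝟙 (count (∁? P?) ys ≟ i)) (subsequences xs)
    ih : ∀ j i → with-counts j i ≡ (c C j) * (c̄ C i)
    ih = ∑-subsequences-counts xs
    by-head : (d : Dec (P x)) (j i : ℕ) →
      ∑ (λ ys → 𝟙 (𝟙 d + count P? ys ≟ j) * 𝟙 (𝟙 (¬? d) + count (∁? P?) ys ≟ i)) (subsequences xs)
        + with-counts j i
        ≡ ((𝟙 d + c) C j) * ((𝟙 (¬? d) + c̄) C i)
    by-head (yes _) zero    i       = trans
      (cong (_+ with-counts 0 i) (∑-zero {f = λ _ → 0} (All.universal (λ _ → refl) (subsequences xs))))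
      (ih 0 i)
    by-head (yes _) (suc j) i       = begin
      with-counts j i + with-counts (suc j) i   ≡⟨ cong₂ _+_ (ih j i) (ih (suc j) i) ⟩
      (c C j) * (c̄ C i) + (c C suc j) * (c̄ C i) ≡⟨ *-distribʳ-+ (c̄ C i) (c C j) (c C suc j) ⟨
      (c C j + c C suc j) * (c̄ C i)             ≡⟨ cong (_* (c̄ C i)) (nCk+nC[k+1]≡[n+1]C[k+1] c j) ⟩
      (suc c C suc j) * (c̄ C i)                 ∎
      where open ≡-Reasoning
    by-head (no _)  j       zero    = trans
      (cong (_+ with-counts j 0)
        (∑-zero {f = λ ys → 𝟙 (count P? ys ≟ j) * 0}
          (All.universal (λ ys → *-zeroʳ (𝟙 (count P? ys ≟ j))) (subsequences xs))))
      (ih j 0)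
    by-head (no _)  j       (suc i) = begin
      with-counts j i + with-counts j (suc i)   ≡⟨ cong₂ _+_ (ih j i) (ih j (suc i)) ⟩
      (c C j) * (c̄ C i) + (c C j) * (c̄ C suc i) ≡⟨ *-distribˡ-+ (c C j) (c̄ C i) (c̄ C suc i) ⟨
      (c C j) * (c̄ C i + c̄ C suc i)             ≡⟨ cong ((c C j) *_) (nCk+nC[k+1]≡[n+1]C[k+1] c̄ i) ⟩
      (c C j) * (suc c̄ C suc i)                 ∎
      where open ≡-Reasoning

2*nC2+n≡n*n : ∀ n → 2 * (n C 2) + n ≡ n * n
2*nC2+n≡n*n zero    = refl
2*nC2+n≡n*n (suc n) = begin
  2 * (suc n C 2) + suc n         ≡⟨ cong (λ c → 2 * c + suc n) ([1+n]C2≡n+nC2 n) ⟩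
  2 * (n + n C 2) + suc n         ≡⟨ expand n (n C 2) ⟩
  (2 * (n C 2) + n) + (2 * n + 1) ≡⟨ cong (_+ (2 * n + 1)) (2*nC2+n≡n*n n) ⟩
  n * n + (2 * n + 1)             ≡⟨ square n ⟩
  suc n * suc n                   ∎
  where
  open ≡-Reasoning
  expand : ∀ n c → 2 * (n + c) + suc n ≡ (2 * c + n) + (2 * n + 1)
  expand = solve-∀
  square : ∀ n → n * n + (2 * n + 1) ≡ suc n * suc n
  square = solve-∀

[3n]C2≡9*nC2+3n : ∀ n → (3 * n) C 2 ≡ 9 * (n C 2) + 3 * n
[3n]C2≡9*nC2+3n n = *-cancelˡ-≡ _ _ 2 (+-cancelʳ-≡ (3 * n) _ _ (begin
  2 * ((3 * n) C 2) + 3 * n         ≡⟨ 2*nC2+n≡n*n (3 * n) ⟩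
  3 * n * (3 * n)                   ≡⟨ nine n ⟩
  9 * (n * n)                       ≡⟨ cong (9 *_) (2*nC2+n≡n*n n) ⟨
  9 * (2 * (n C 2) + n)             ≡⟨ regroup n (n C 2) ⟩
  2 * (9 * (n C 2) + 3 * n) + 3 * n ∎))
  where
  open ≡-Reasoning
  nine : ∀ n → 3 * n * (3 * n) ≡ 9 * (n * n)
  nine = solve-∀
  regroup : ∀ n c → 9 * (2 * c + n) ≡ 2 * (9 * c + 3 * n) + 3 * n
  regroup = solve-∀

nC2*[n∸2]≡3*nC3 : ∀ n → (n C 2) * (n ∸ 2) ≡ 3 * (n C 3)
nC2*[n∸2]≡3*nC3 0                   = refl
nC2*[n∸2]≡3*nC3 1                   = refl
nC2*[n∸2]≡3*nC3 2                   = refl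
nC2*[n∸2]≡3*nC3 (suc (suc (suc m))) = begin
  (suc N C 2) * suc m     ≡⟨ cong (_* suc m) ([1+n]C2≡n+nC2 N) ⟩
  (N + c) * suc m         ≡⟨ expand N c m ⟩
  N * suc m + c + c * m   ≡⟨ cong₂ (λ a b → a + c + b) N*[N∸1]≡2c (nC2*[n∸2]≡3*nC3 (suc (suc m))) ⟩
  2 * c + c + 3 * (N C 3) ≡⟨ collect c (N C 3) ⟩
  3 * (c + N C 3)         ≡⟨ cong (3 *_) ([1+n]C3≡nC2+nC3 N) ⟨
  3 * (suc N C 3)         ∎
  where
  open ≡-Reasoning
  N c : ℕ
  N = suc (suc m)
  c = N C 2
  expand : ∀ n c m → (n + c) * suc m ≡ n * suc m + c + c * m
  expand = solve-∀
  collect : ∀ c t → 2 * c + c + 3 * t ≡ 3 * (c + t)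
  collect = solve-∀
  square : ∀ m → suc (suc m) * suc m + suc (suc m) ≡ suc (suc m) * suc (suc m)
  square = solve-∀
  N*[N∸1]≡2c : N * suc m ≡ 2 * c
  N*[N∸1]≡2c = +-cancelʳ-≡ N _ _ (trans (square m) (sym (2*nC2+n≡n*n N)))

double-counts⇒bound : ∀ {n d₂ d₃ k} →
  d₂ + 3 * d₃ + 3 * n ≤ (3 * n) C 2 → d₂ * (n ∸ 2) ≤ (n C 3) * k →
  3 * ((d₂ + d₃) * (n ∸ 2)) ≤ (27 + 2 * k) * (n C 3)
double-counts⇒bound {n} {d₂} {d₃} {k} pairs triples = begin
  3 * ((d₂ + d₃) * (n ∸ 2))
    ≡⟨ split d₂ d₃ (n ∸ 2) ⟩
  (d₂ + 3 * d₃) * (n ∸ 2) + 2 * (d₂ * (n ∸ 2))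
    ≤⟨ +-mono-≤ (*-monoˡ-≤ (n ∸ 2) pairs′) (*-monoʳ-≤ 2 triples) ⟩
  9 * (n C 2) * (n ∸ 2) + 2 * ((n C 3) * k)
    ≡⟨ cong (_+ 2 * ((n C 3) * k)) (trans (*-assoc 9 (n C 2) (n ∸ 2)) (cong (9 *_) (nC2*[n∸2]≡3*nC3 n))) ⟩
  9 * (3 * (n C 3)) + 2 * ((n C 3) * k)
    ≡⟨ collect (n C 3) k ⟩
  (27 + 2 * k) * (n C 3)
    ∎
  where
  open ≤-Reasoning
  pairs′ : d₂ + 3 * d₃ ≤ 9 * (n C 2)
  pairs′ = +-cancelʳ-≤ (3 * n) _ _ (≤-trans pairs (≤-reflexive ([3n]C2≡9*nC2+3n n)))
  split : ∀ a b m → 3 * ((a + b) * m) ≡ (a + 3 * b) * m + 2 * (a * m)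
  split = solve-∀
  collect : ∀ t k → 9 * (3 * t) + 2 * (t * k) ≡ (27 + 2 * k) * t
  collect = solve-∀

𝟙[a+b≟3]*𝟙[a≟2]≡𝟙[a≟2]*𝟙[b≟1] : ∀ a b → 𝟙 (a + b ≟ 3) * 𝟙 (a ≟ 2) ≡ 𝟙 (a ≟ 2) * 𝟙 (b ≟ 1)
𝟙[a+b≟3]*𝟙[a≟2]≡𝟙[a≟2]*𝟙[b≟1] 0                   b = *-zeroʳ (𝟙 (b ≟ 3))
𝟙[a+b≟3]*𝟙[a≟2]≡𝟙[a≟2]*𝟙[b≟1] 1                   b = *-zeroʳ (𝟙 (b ≟ 2))
𝟙[a+b≟3]*𝟙[a≟2]≡𝟙[a≟2]*𝟙[b≟1] 2                   b = trans (*-identityʳ _) (sym (+-identityʳ _))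
𝟙[a+b≟3]*𝟙[a≟2]≡𝟙[a≟2]*𝟙[b≟1] (suc (suc (suc a))) b = *-zeroʳ (𝟙 (a + b ≟ 0))

2≢3 : 2 ≢ 3
2≢3 ()

module _ {v : ℕ} {F M : List (Subset v)}
  (F-unique : IsFamily F) (uniform : ThreeUniform F) (linear : Linear F)
  (M-unique : Unique M) (M⊆F : ∀ {A} → A ∈ M → A ∈ F)
  (M-disjoint : ∀ {A B} → A ∈ M → B ∈ M → A ≢ B → Disjoint A B) where

  M-pairwise-disjoint : AllPairs Disjoint M
  M-pairwise-disjoint = AllPairs-map-∈ M-disjoint M-unique

  ∣∩X∣-member : ∀ {A} → A ∈ M → ∣ A ∩ X M ∣ ≡ 3
  ∣∩X∣-member {A} A∈M = begin
    ∣ A ∩ X M ∣           ≡⟨ ∣∩⋃∣≡∑ A M-pairwise-disjoint ⟩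
    ∑ (λ B → ∣ A ∩ B ∣) M ≡⟨ ∑-single M-unique A∈M others ⟩
    ∣ A ∩ A ∣             ≡⟨ cong ∣_∣ (∩-idem A) ⟩
    ∣ A ∣                 ≡⟨ uniform (M⊆F A∈M) ⟩
    3                     ∎
    where
    open ≡-Reasoning
    others : ∀ {B} → B ∈ M → B ≢ A → ∣ A ∩ B ∣ ≡ 0
    others B∈M B≢A = trans (cong ∣_∣ (∩-comm A _)) (M-disjoint B∈M A∈M B≢A)

  ∣X∣≡3n : ∣ X M ∣ ≡ 3 * length M
  ∣X∣≡3n = begin
    ∣ X M ∣               ≡⟨ cong ∣_∣ (∩-identityˡ (X M)) ⟨
    ∣ ⊤ ∩ X M ∣           ≡⟨ ∣∩⋃∣≡∑ ⊤ M-pairwise-disjoint ⟩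
    ∑ (λ A → ∣ ⊤ ∩ A ∣) M ≡⟨ ∑-const {f = λ A → ∣ ⊤ ∩ A ∣} (All.tabulate ∣⊤∩A∣≡3) ⟩
    length M * 3          ≡⟨ *-comm (length M) 3 ⟩
    3 * length M          ∎
    where
    open ≡-Reasoning
    ∣⊤∩A∣≡3 : ∀ {A} → A ∈ M → ∣ ⊤ ∩ A ∣ ≡ 3
    ∣⊤∩A∣≡3 {A} A∈M = trans (cong ∣_∣ (∩-identityˡ A)) (uniform (M⊆F A∈M))

  ∈D⁻ : ∀ {i E} → E ∈ D i F M → E ∈ F × ∣ E ∩ X M ∣ ≡ i
  ∈D⁻ {i} = ∈-filter⁻ (λ A → ∣ A ∩ X M ∣ ≟ i)

  ∈D3∖M⁻ : ∀ {E} → E ∈ D3∖M F M → E ∈ D 3 F M × E ∉ M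
  ∈D3∖M⁻ = ∈-filter⁻ (λ E → ¬? (E ∈?ₛ M))

  ∣∩X∣-D3∖M++M : ∀ {E} → E ∈ D3∖M F M ++ M → ∣ E ∩ X M ∣ ≡ 3
  ∣∩X∣-D3∖M++M E∈ with ∈-++⁻ (D3∖M F M) E∈
  ... | inj₁ E∈D₃ = proj₂ (∈D⁻ (proj₁ (∈D3∖M⁻ E∈D₃)))
  ... | inj₂ E∈M  = ∣∩X∣-member E∈M

  pair-count : length (D 2 F M) + 3 * length (D3∖M F M) + 3 * length M ≤ (3 * length M) C 2
  pair-count = begin
    length (D 2 F M) + 3 * length (D3∖M F M) + 3 * length M
      ≡⟨ regroup (length (D 2 F M)) (length (D3∖M F M)) (length M) ⟩
    length (D 2 F M) * 1 + (length (D3∖M F M) + length M) * 3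
      ≡⟨ cong (λ l → length (D 2 F M) * 1 + l * 3) (length-++ (D3∖M F M)) ⟨
    length (D 2 F M) * 1 + length (D3∖M F M ++ M) * 3
      ≡⟨ cong₂ _+_ (∑-const (All.tabulate (λ E∈D₂ → cong (_C 2) (proj₂ (∈D⁻ E∈D₂)))))
                   (∑-const (All.tabulate (λ E∈ → cong (_C 2) (∣∩X∣-D3∖M++M E∈)))) ⟨
    ∑ (λ E → ∣ E ∩ X M ∣ C 2) (D 2 F M) + ∑ (λ E → ∣ E ∩ X M ∣ C 2) (D3∖M F M ++ M)
      ≡⟨ ∑-++ (D 2 F M) (D3∖M F M ++ M) ⟨
    ∑ (λ E → ∣ E ∩ X M ∣ C 2) L
      ≤⟨ ∑C2-≤ (X M) L-almostDisjoint ⟩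
    ∣ X M ∣ C 2
      ≡⟨ cong (_C 2) ∣X∣≡3n ⟩
    (3 * length M) C 2
      ∎
    where
    open ≤-Reasoning
    L : List (Subset v)
    L = D 2 F M ++ D3∖M F M ++ M
    regroup : ∀ a b c → a + 3 * b + 3 * c ≡ a * 1 + (b + c) * 3
    regroup = solve-∀
    L⊆F : All (_∈ F) L
    L⊆F = Allₚ.++⁺ (All.tabulate (proj₁ ∘ ∈D⁻))
            (Allₚ.++⁺ (All.tabulate (proj₁ ∘ ∈D⁻ ∘ proj₁ ∘ ∈D3∖M⁻)) (All.tabulate M⊆F))
    L-unique : Unique L
    L-unique = Uniqueₚ.++⁺ (Uniqueₚ.filter⁺ _ F-unique)
      (Uniqueₚ.++⁺ (Uniqueₚ.filter⁺ _ (Uniqueₚ.filter⁺ _ F-unique)) M-unique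
        (λ (E∈D₃ , E∈M) → proj₂ (∈D3∖M⁻ E∈D₃) E∈M))
      (λ (E∈D₂ , E∈) → 2≢3 (trans (sym (proj₂ (∈D⁻ E∈D₂))) (∣∩X∣-D3∖M++M E∈)))
    L-almostDisjoint : AllPairs AlmostDisjoint L
    L-almostDisjoint = AllPairs-map-∈ (λ E∈L E′∈L → linear (All.lookup L⊆F E∈L) (All.lookup L⊆F E′∈L)) L-unique

  Triples : List (List (Subset v))
  Triples = filter (λ ys → length ys ≟ 3) (subsequences M)

  D₂-through : List (Subset v) → ℕ
  D₂-through ys = count (λ E → ∣ E ∩ ⋃ ys ∣ ≟ 2) (D 2 F M)

  -- A member of D₂ meets exactly two members of M, so it lies in D₂(A,B,C) exactly
  -- for the triples containing both.
  triples-through : ∀ {E} → E ∈ D 2 F M → ∑ (λ ys → 𝟙 (∣ E ∩ ⋃ ys ∣ ≟ 2)) Triples ≡ length M ∸ 2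
  triples-through {E} E∈D₂ = begin
    ∑ (λ ys → 𝟙 (∣ E ∩ ⋃ ys ∣ ≟ 2)) Triples
      ≡⟨ ∑-filter (λ ys → length ys ≟ 3) (λ ys → 𝟙 (∣ E ∩ ⋃ ys ∣ ≟ 2)) (subsequences M) ⟩
    ∑ (λ ys → 𝟙 (length ys ≟ 3) * 𝟙 (∣ E ∩ ⋃ ys ∣ ≟ 2)) (subsequences M)
      ≡⟨ ∑-cong (All.map by-counts (subsequences-⊆ M)) ⟩
    ∑ (λ ys → 𝟙 (count meets? ys ≟ 2) * 𝟙 (count (∁? meets?) ys ≟ 1)) (subsequences M)
      ≡⟨ ∑-subsequences-counts meets? M 2 1 ⟩
    (count meets? M C 2) * (count (∁? meets?) M C 1)
      ≡⟨ cong₂ (λ a b → (a C 2) * (b C 1)) meets-two misses-rest ⟩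
    (2 C 2) * ((length M ∸ 2) C 1)
      ≡⟨ trans (+-identityʳ _) (nC1≡n _) ⟩
    length M ∸ 2
      ∎
    where
    open ≡-Reasoning
    meets? : Decidable (λ A → ∣ E ∩ A ∣ ≡ 1)
    meets? A = ∣ E ∩ A ∣ ≟ 1
    at-most-once : All (λ A → ∣ E ∩ A ∣ ≤ 1) M
    at-most-once = All.tabulate λ A∈M → linear (proj₁ (∈D⁻ E∈D₂)) (M⊆F A∈M) λ E≡A →
      2≢3 (trans (sym (proj₂ (∈D⁻ E∈D₂))) (trans (cong (λ Z → ∣ Z ∩ X M ∣) E≡A) (∣∩X∣-member A∈M)))
    weight : ∀ {ys} → AllPairs Disjoint ys → All (λ A → ∣ E ∩ A ∣ ≤ 1) ys →
      ∣ E ∩ ⋃ ys ∣ ≡ count meets? ys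
    weight ys# ys≤1 = trans (∣∩⋃∣≡∑ E ys#) (∑-bits (λ A → ∣ E ∩ A ∣) ys≤1)
    by-counts : ∀ {ys} → ys ⊆ M →
      𝟙 (length ys ≟ 3) * 𝟙 (∣ E ∩ ⋃ ys ∣ ≟ 2)
        ≡ 𝟙 (count meets? ys ≟ 2) * 𝟙 (count (∁? meets?) ys ≟ 1)
    by-counts {ys} ys⊆M
      rewrite weight (AllPairs-resp-⊆ ys⊆M M-pairwise-disjoint) (All-resp-⊆ ys⊆M at-most-once)
            | length≡count+count∁ meets? ys
      = 𝟙[a+b≟3]*𝟙[a≟2]≡𝟙[a≟2]*𝟙[b≟1] (count meets? ys) (count (∁? meets?) ys)
    meets-two : count meets? M ≡ 2
    meets-two = trans (sym (weight M-pairwise-disjoint at-most-once)) (proj₂ (∈D⁻ E∈D₂))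
    misses-rest : count (∁? meets?) M ≡ length M ∸ 2
    misses-rest = trans (sym (m+n∸m≡n 2 (count (∁? meets?) M)))
      (cong (_∸ 2) (sym (trans (length≡count+count∁ meets? M) (cong (_+ count (∁? meets?) M) meets-two))))

  TriplesBounded : ℕ → Set
  TriplesBounded k = ∀ {A B C} → A ∈ M → B ∈ M → C ∈ M → A ≢ B → B ≢ C → A ≢ C →
    length (D2₃ F M A B C) ≤ k

  D₂-through-≤ : ∀ {k} → TriplesBounded k → ∀ {ys} → length ys ≡ 3 × ys ⊆ M → D₂-through ys ≤ k
  D₂-through-≤ bounded {[]}                (() , _)
  D₂-through-≤ bounded {_ ∷ []}            (() , _)
  D₂-through-≤ bounded {_ ∷ _ ∷ []}        (() , _)
  D₂-through-≤ bounded {_ ∷ _ ∷ _ ∷ _ ∷ _} (() , _)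
  D₂-through-≤ {k} bounded {A ∷ B ∷ C ∷ []} (refl , ys⊆M)
    with AllPairs-resp-⊆ ys⊆M M-unique
  ... | (A≢B ∷ A≢C ∷ []) ∷ (B≢C ∷ []) ∷ [] ∷ [] = begin
    count (λ E → ∣ E ∩ ⋃ (A ∷ B ∷ C ∷ []) ∣ ≟ 2) (D 2 F M)
      ≡⟨ length-filter≡count _ (D 2 F M) ⟨
    length (filter (λ E → ∣ E ∩ (A ∪ (B ∪ (C ∪ _))) ∣ ≟ 2) (D 2 F M))
      ≡⟨ cong (λ Z → length (filter (λ E → ∣ E ∩ (A ∪ (B ∪ Z)) ∣ ≟ 2) (D 2 F M))) (∪-identityʳ C) ⟩
    length (D2₃ F M A B C)
      ≤⟨ bounded (member (here refl)) (member (there (here refl))) (member (there (there (here refl))))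
                 A≢B B≢C A≢C ⟩
    k ∎
    where
    open ≤-Reasoning
    member : ∀ {Z} → Z ∈ (A ∷ B ∷ C ∷ []) → Z ∈ M
    member = Any-resp-⊆ ys⊆M

  triple-count : ∀ {k} → TriplesBounded k → length (D 2 F M) * (length M ∸ 2) ≤ (length M C 3) * k
  triple-count {k} bounded = begin
    length (D 2 F M) * (length M ∸ 2)
      ≡⟨ ∑-const (All.tabulate triples-through) ⟨
    ∑ (λ E → ∑ (λ ys → 𝟙 (∣ E ∩ ⋃ ys ∣ ≟ 2)) Triples) (D 2 F M)
      ≡⟨ ∑-swap (λ E ys → 𝟙 (∣ E ∩ ⋃ ys ∣ ≟ 2)) (D 2 F M) Triples ⟩
    ∑ D₂-through Triples
      ≤⟨ ∑-≤-const (All.map (D₂-through-≤ bounded) (All.zip (triples-of-size-3 , triples-⊆-M))) ⟩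
    length Triples * k
      ≡⟨ cong (_* k) (trans (length-filter≡count _ (subsequences M)) (∑-subsequences-length M 3)) ⟩
    (length M C 3) * k
      ∎
    where
    open ≤-Reasoning
    triples-of-size-3 : All (λ ys → length ys ≡ 3) Triples
    triples-of-size-3 = Allₚ.all-filter (λ ys → length ys ≟ 3) (subsequences M)
    triples-⊆-M : All (_⊆ M) Triples
    triples-⊆-M = Allₚ.filter⁺ (λ ys → length ys ≟ 3) (subsequences-⊆ M)

proposition9 : (v : ℕ) (F M : List (Subset v)) →
    IsFamily F → ThreeUniform F → Linear F → IsMatching F M →
    3 ≤ length M →
    (∀ {A B C} → A ∈ M → B ∈ M → C ∈ M → A ≢ B → B ≢ C → A ≢ C →
      length (D2₃ F M A B C) ≤ 21) →
    (length (D 2 F M) + length (D3∖M F M)) * (length M ∸ 2) ≤ 23 * (length M C 3)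
proposition9 v F M F-unique uniform linear (M-unique , M⊆F , M-disjoint) _ bounded =
  *-cancelˡ-≤ 3 (≤-trans
    (double-counts⇒bound {length M} {length (D 2 F M)} {length (D3∖M F M)} {21}
      (pair-count F-unique uniform linear M-unique M⊆F M-disjoint)
      (triple-count F-unique uniform linear M-unique M⊆F M-disjoint bounded))
    (≤-reflexive (*-assoc 3 23 (length M C 3))))
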